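{- Let $s\ge 2$ be an integer and let $G$ be a graph with maximum degree at most $\Delta$ whose vertex set is partitioned into nonempty parts $V(G)=V_1\cup\cdots\cup V_r$ with $|V_i|\ge 2\left\lfloor\frac{\Delta}{s-1}\right\rfloor$ for all $i$. Then $G$ has a $K_s$-free transversal.
   Context: Given a graph $G$ whose vertex set is partitioned into parts $V_1,\dots,V_r$: a transversal is a subset of $V(G)$ containing exactly one vertex from each part; a $K_s$-free transversal is a transversal $T$ such that the induced subgraph $G[T]$ contains no clique on $s$ vertices. -}

module Defs where

open import Data.Nat using (ℕ; zero; suc; _≤_; _∸_)
open import Data.Nat.DivMod using (_/_)
open import Data.Fin using (Fin)
open import Data.Bool using (Bool; true; false; T)
open import Data.List using (List; length; filterᵇ; allFin)
open import Data.Product using (Σ; ∃; _×_)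
open import Relation.Binary.PropositionalEquality using (_≡_; _≢_)
open import Relation.Nullary using (¬_)
open import Data.Fin using (_≟_)
open import Relation.Nullary.Decidable using (⌊_⌋)

record Graph (n : ℕ) : Set where
  field
    adj      : Fin n → Fin n → Bool
    symmetric   : ∀ u v → adj u v ≡ adj v u
    irreflexive : ∀ v → adj v v ≡ false

open Graph public

degree : ∀ {n} → Graph n → Fin n → ℕ
degree G v = length (filterᵇ (adj G v) (allFin _))

MaxDegreeAtMost : ∀ {n} → Graph n → ℕ → Set
MaxDegreeAtMost G Δ = ∀ v → degree G v ≤ Δ

-- A partition of V(G) = Fin n into r parts V_1..V_r is given by the map
-- assigning to each vertex the index of its part.
-- size of the part V_i
partSize : ∀ {n r} → (Fin n → Fin r) → Fin r → ℕ
partSize {n} part i = length (filterᵇ (λ v → ⌊ part v ≟ i ⌋) (allFin n))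

-- A transversal: exactly one vertex from each part, given as a choice
-- function t with t i ∈ V_i.  Its vertex set is the image of t.
record Transversal {n r : ℕ} (part : Fin n → Fin r) : Set where
  field
    pick    : Fin r → Fin n
    pick-in : ∀ i → part (pick i) ≡ i

open Transversal public

InTransversal : ∀ {n r} {part : Fin n → Fin r} → Transversal part → Fin n → Set
InTransversal T v = ∃ λ i → pick T i ≡ v

HasCliqueIn : ∀ {n r} {part : Fin n → Fin r} → Graph n → Transversal part → ℕ → Set
HasCliqueIn {n} G Tr s =
  Σ (Fin s → Fin n) λ c →
    (∀ j → InTransversal Tr (c j)) ×
    (∀ j k → j ≢ k → T (adj G (c j) (c k)))

KsFree : ∀ {n r} {part : Fin n → Fin r} → Graph n → Transversal part → ℕ → Set
KsFree G Tr s = ¬ HasCliqueIn G Tr s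

-- ⌊ Δ / m ⌋ for m ≥ 1 (value at m = 0 irrelevant; only used with m = s - 1 ≥ 1)
floorDiv : ℕ → ℕ → ℕ
floorDiv Δ zero    = 0
floorDiv Δ (suc m) = Δ / suc m

-- Let k = s - 1 and d = ⌊Δ/k⌋.
--  * Lovász (localColouring): V(G) can be coloured with k colours so that
--    every vertex has at most d neighbours of its own colour; the subgraph
--    of monochromatic edges then has maximum degree at most d.  A colouring
--    with the fewest monochromatic edges works, since recolouring a violating
--    vertex with its rarest neighbouring colour removes monochromatic edges.
--  * Haxell (haxell): a graph of maximum degree d whose parts have at least
--    2d vertices has an independent transversal; it is built part by part
--    with an augmenting search.
--  * An independent transversal T of the monochromatic subgraph is K_s-free
--    in G: among s vertices of a clique of T, two share one of the k colours
--    by pigeonhole, and would form a monochromatic edge inside T.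
module Submission where

open import Defs
open import Data.Nat using (ℕ; zero; suc; _+_; _*_; _∸_; _≤_; _<_; z≤n; s≤s; _≤?_; _<?_)
open import Data.Nat.Properties hiding (_≟_)
open import Data.Nat.DivMod using (_/_; _%_; m≡m%n+[m/n]*n; m%n<n)
open import Algebra.Properties.CommutativeMonoid.Sum +-0-commutativeMonoid
  using (sum; ∑-distrib-+; ∑-comm; sum-cong-≗; sum-replicate-zero)
open import Data.Fin using (Fin; _≟_) renaming (zero to fzero; suc to fsuc)
open import Data.Fin.Properties using (any?; pigeonhole) renaming (<⇒≢ to <⇒≢ᶠ)
open import Data.Bool using (Bool; true; false; _∧_; _∨_; not; if_then_else_)
open import Data.Bool.Properties using (¬-not; ∨-conicalˡ; ∨-conicalʳ; T-≡) renaming (_≟_ to _≟ᵇ_)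
open import Data.List using (List; []; _∷_; length; filterᵇ; tabulate; allFin)
open import Data.List.Membership.Propositional using (_∈_)
open import Data.List.Membership.Propositional.Properties using (∈-allFin)
open import Data.List.Relation.Unary.Any using (here; there)
open import Data.Maybe using (Maybe; just; nothing)
open import Data.Maybe.Properties using (just-injective)
open import Data.Unit using (⊤; tt)
open import Data.Product using (Σ; ∃; _×_; _,_; proj₁; proj₂)
open import Data.Sum using (_⊎_; inj₁; inj₂)
open import Data.Empty using (⊥; ⊥-elim)
open import Function using (_∘_; id; Equivalence)
open import Relation.Binary.PropositionalEquality
open import Relation.Nullary using (¬_; yes; no)
open import Relation.Nullary.Decidable using (⌊_⌋)

true≢false : true ≡ false → ⊥
true≢false ()

≟-true : ∀ {k} {a b : Fin k} → a ≡ b → ⌊ a ≟ b ⌋ ≡ true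
≟-true {a = a} {b} a≡b with a ≟ b
... | yes _ = refl
... | no a≢b = ⊥-elim (a≢b a≡b)

≟-false : ∀ {k} {a b : Fin k} → ¬ a ≡ b → ⌊ a ≟ b ⌋ ≡ false
≟-false {a = a} {b} a≢b with a ≟ b
... | yes a≡b = ⊥-elim (a≢b a≡b)
... | no _ = refl

≟-sym : ∀ {k} (a b : Fin k) → ⌊ a ≟ b ⌋ ≡ ⌊ b ≟ a ⌋
≟-sym a b with a ≟ b
... | yes a≡b = sym (≟-true (sym a≡b))
... | no a≢b = sym (≟-false (λ b≡a → a≢b (sym b≡a)))

search : ∀ {m} (f : Fin m → Bool) → (∃ λ z → f z ≡ true) ⊎ (∀ z → f z ≡ false)
search f with any? (λ z → f z ≟ᵇ true)
... | yes found = inj₁ found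
... | no none = inj₂ (λ z → ¬-not (λ fz≡true → none (z , fz≡true)))

sum-mono-≤ : ∀ {m} {f g : Fin m → ℕ} → (∀ z → f z ≤ g z) → sum f ≤ sum g
sum-mono-≤ {zero} f≤g = z≤n
sum-mono-≤ {suc m} f≤g = +-mono-≤ (f≤g fzero) (sum-mono-≤ (f≤g ∘ fsuc))

sum-mono-< : ∀ {m} {f g : Fin m → ℕ} → (∀ z → f z ≤ g z) → ∀ z → f z < g z → sum f < sum g
sum-mono-< {suc m} f≤g fzero lt = +-mono-<-≤ lt (sum-mono-≤ (f≤g ∘ fsuc))
sum-mono-< {suc m} f≤g (fsuc z) lt = +-mono-≤-< (f≤g fzero) (sum-mono-< (f≤g ∘ fsuc) z lt)

sum-witness : ∀ {m} (f : Fin m → ℕ) → 0 < sum f → ∃ λ z → 0 < f z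
sum-witness {suc m} f pos with f fzero in eq
... | suc _ = fzero , subst (0 <_) (sym eq) (s≤s z≤n)
... | zero with sum-witness (f ∘ fsuc) pos
...   | z , fz>0 = fsuc z , fz>0

sum-lower : ∀ {m} (a : ℕ) (f : Fin m → ℕ) → (∀ z → a ≤ f z) → m * a ≤ sum f
sum-lower {zero} a f a≤f = z≤n
sum-lower {suc m} a f a≤f = +-mono-≤ (a≤f fzero) (sum-lower a (f ∘ fsuc) (a≤f ∘ fsuc))

sum-point : ∀ {m} (u : Fin m) (g : Fin m → ℕ) → sum (λ w → if ⌊ w ≟ u ⌋ then g w else 0) ≡ g u
sum-point {suc m} fzero g = trans (cong (g fzero +_) (sum-replicate-zero m)) (+-identityʳ _)
sum-point {suc m} (fsuc u) g = trans (sum-cong-≗ restrict) (sum-point u (g ∘ fsuc))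
  where
  restrict : ∀ z → (if ⌊ fsuc z ≟ fsuc u ⌋ then g (fsuc z) else 0) ≡ (if ⌊ z ≟ u ⌋ then g (fsuc z) else 0)
  restrict z with z ≟ u
  ... | yes _ = refl
  ... | no _ = refl

bit : Bool → ℕ
bit true = 1
bit false = 0

count : ∀ {m} → (Fin m → Bool) → ℕ
count f = sum (λ z → bit (f z))

length-filter : ∀ {m} {A : Set} (f : A → Bool) (g : Fin m → A) → length (filterᵇ f (tabulate g)) ≡ count (f ∘ g)
length-filter {zero} f g = refl
length-filter {suc m} f g with f (g fzero)
... | true = cong suc (length-filter f (g ∘ fsuc))
... | false = length-filter f (g ∘ fsuc)

count-≤-size : ∀ {m} (f : Fin m → Bool) → count f ≤ m
count-≤-size {zero} f = z≤n
count-≤-size {suc m} f with f fzero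
... | true = s≤s (count-≤-size (f ∘ fsuc))
... | false = m≤n⇒m≤1+n (count-≤-size (f ∘ fsuc))

bit-mono : ∀ {a b} → (a ≡ true → b ≡ true) → bit a ≤ bit b
bit-mono {true} a⇒b rewrite a⇒b refl = ≤-refl
bit-mono {false} a⇒b = z≤n

count-mono : ∀ {m} {f g : Fin m → Bool} → (∀ z → f z ≡ true → g z ≡ true) → count f ≤ count g
count-mono f⇒g = sum-mono-≤ (λ z → bit-mono (f⇒g z))

count-mono-< : ∀ {m} {f g : Fin m → Bool} → (∀ z → f z ≡ true → g z ≡ true) →
  ∀ z → f z ≡ false → g z ≡ true → count f < count g
count-mono-< f⇒g z fz gz = sum-mono-< (λ w → bit-mono (f⇒g w)) z
  (subst₂ (λ a b → bit a < bit b) (sym fz) (sym gz) (s≤s z≤n))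

count-witness : ∀ {m} (f : Fin m → Bool) → 0 < count f → ∃ λ z → f z ≡ true
count-witness f pos with sum-witness (bit ∘ f) pos
... | z , bit>0 with f z in eq
...   | true = z , eq
...   | false with bit>0
...     | ()

count-∨ : ∀ {m} (f g : Fin m → Bool) → count (λ z → f z ∨ g z) ≤ count f + count g
count-∨ f g = ≤-trans (sum-mono-≤ (λ z → bit-∨ (f z) (g z))) (≤-reflexive (∑-distrib-+ (bit ∘ f) (bit ∘ g)))
  where
  bit-∨ : ∀ a b → bit (a ∨ b) ≤ bit a + bit b
  bit-∨ true b = s≤s z≤n
  bit-∨ false b = ≤-refl

count-disjoint : ∀ {m} (f g : Fin m → Bool) → (∀ z → f z ≡ true → g z ≡ true → ⊥) →
  count f + count g ≤ count (λ z → f z ∨ g z)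
count-disjoint f g disjoint = ≤-trans (≤-reflexive (sym (∑-distrib-+ (bit ∘ f) (bit ∘ g))))
  (sum-mono-≤ (λ z → bit-disjoint (f z) (g z) (disjoint z)))
  where
  bit-disjoint : ∀ a b → (a ≡ true → b ≡ true → ⊥) → bit a + bit b ≤ bit (a ∨ b)
  bit-disjoint true true both = ⊥-elim (both refl refl)
  bit-disjoint true false _ = ≤-refl
  bit-disjoint false b _ = ≤-refl

monochromatic : ∀ {n k} → Graph n → (Fin n → Fin k) → Graph n
monochromatic G col = record
  { adj = λ u v → adj G u v ∧ ⌊ col v ≟ col u ⌋
  ; symmetric = λ u v → cong₂ _∧_ (symmetric G u v) (≟-sym (col v) (col u))
  ; irreflexive = λ v → cong (_∧ ⌊ col v ≟ col v ⌋) (irreflexive G v)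
  }

degree-count : ∀ {n} (G : Graph n) (u : Fin n) → degree G u ≡ count (adj G u)
degree-count G u = length-filter (adj G u) id

-- Lovász: the vertices of a graph of maximum degree Δ can be coloured with
-- k = suc m colours so that every vertex has at most ⌊Δ/k⌋ neighbours of its
-- own colour.  A colouring minimising the number of monochromatic ordered
-- edges has this property, since moving a violating vertex to its least
-- represented colour strictly decreases that number.
module LocalColouring {n : ℕ} (G : Graph n) (m Δ : ℕ) (maxDeg : MaxDegreeAtMost G Δ) where

  Colouring : Set
  Colouring = Fin n → Fin (suc m)

  neighboursOfColour : Colouring → Fin n → Fin (suc m) → ℕ
  neighboursOfColour col u k = count (λ v → adj G u v ∧ ⌊ col v ≟ k ⌋)

  -- The potential: the number of ordered monochromatic edges.
  conflicts : Colouring → ℕ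
  conflicts col = sum (λ w → neighboursOfColour col w (col w))

  neighboursOfColour-total : ∀ col u → sum (neighboursOfColour col u) ≡ count (adj G u)
  neighboursOfColour-total col u =
    trans (∑-comm (λ k v → bit (adj G u v ∧ ⌊ col v ≟ k ⌋)))
          (sum-cong-≗ (λ v → oneClass (adj G u v) (col v)))
    where
    oneClass : ∀ a (c : Fin (suc m)) → sum (λ k → bit (a ∧ ⌊ c ≟ k ⌋)) ≡ bit a
    oneClass false c = sum-replicate-zero (suc m)
    oneClass true c = trans (sum-cong-≗ flip) (sum-point c (λ _ → 1))
      where
      flip : ∀ k → bit ⌊ c ≟ k ⌋ ≡ (if ⌊ k ≟ c ⌋ then 1 else 0)
      flip k rewrite ≟-sym c k with k ≟ c
      ... | yes _ = refl
      ... | no _ = refl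

  -- Pigeonhole on the colour classes: since Δ < k * (⌊Δ/k⌋ + 1), some colour
  -- occurs at most ⌊Δ/k⌋ times among the neighbours of u.
  rareColour : ∀ col u → ∃ λ k → neighboursOfColour col u k ≤ Δ / suc m
  rareColour col u with any? (λ k → neighboursOfColour col u k ≤? Δ / suc m)
  ... | yes rare = rare
  ... | no none = ⊥-elim (<⇒≱ Δ<k[d+1] (begin
        suc m * suc (Δ / suc m)  ≤⟨ sum-lower _ (neighboursOfColour col u) (λ k → ≰⇒> (λ le → none (k , le))) ⟩
        sum (neighboursOfColour col u) ≡⟨ neighboursOfColour-total col u ⟩
        count (adj G u)          ≡⟨ sym (degree-count G u) ⟩
        degree G u               ≤⟨ maxDeg u ⟩
        Δ                        ∎))
    where
    open ≤-Reasoning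
    Δ<k[d+1] : Δ < suc m * suc (Δ / suc m)
    Δ<k[d+1] = begin-strict
      Δ                                ≡⟨ m≡m%n+[m/n]*n Δ (suc m) ⟩
      Δ % suc m + Δ / suc m * suc m    <⟨ +-monoˡ-< (Δ / suc m * suc m) (m%n<n Δ (suc m)) ⟩
      suc m + Δ / suc m * suc m        ≡⟨ *-comm (suc (Δ / suc m)) (suc m) ⟩
      suc m * suc (Δ / suc m)          ∎

  module Recolour (col : Colouring) (u : Fin n) (c : Fin (suc m)) where
    recoloured : Colouring
    recoloured v = if ⌊ v ≟ u ⌋ then c else col v

    ∑∑ : (Fin n → Fin n → ℕ) → ℕ
    ∑∑ f = sum (λ w → sum (f w))

    ∑∑-+ : ∀ f g → ∑∑ (λ w v → f w v + g w v) ≡ ∑∑ f + ∑∑ g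
    ∑∑-+ f g = trans (sum-cong-≗ (λ w → ∑-distrib-+ (f w) (g w))) (∑-distrib-+ (sum ∘ f) (sum ∘ g))

    mono : Colouring → Fin n → Fin n → ℕ
    mono cl w v = bit (adj G w v ∧ ⌊ cl v ≟ cl w ⌋)

    row column : Fin (suc m) → Fin n → Fin n → ℕ
    row k w v = bit (⌊ w ≟ u ⌋ ∧ (adj G w v ∧ ⌊ col v ≟ k ⌋))
    column k w v = bit (⌊ v ≟ u ⌋ ∧ (adj G w v ∧ ⌊ col w ≟ k ⌋))

    row-total : ∀ k → ∑∑ (row k) ≡ neighboursOfColour col u k
    row-total k = trans (sum-cong-≗ onlyRowU) (sum-point u (λ w → neighboursOfColour col w k))
      where
      onlyRowU : ∀ w → sum (row k w) ≡ (if ⌊ w ≟ u ⌋ then neighboursOfColour col w k else 0)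
      onlyRowU w with w ≟ u
      ... | yes _ = refl
      ... | no _ = sum-replicate-zero n

    column-total : ∀ k → ∑∑ (column k) ≡ neighboursOfColour col u k
    column-total k = trans (sum-cong-≗ (λ w → trans (sum-cong-≗ (onlyColumnU w)) (sum-point u (λ v → bit (adj G w v ∧ ⌊ col w ≟ k ⌋)))))
                           (sum-cong-≗ (λ w → cong (λ e → bit (e ∧ ⌊ col w ≟ k ⌋)) (symmetric G w u)))
      where
      onlyColumnU : ∀ w v → column k w v ≡ (if ⌊ v ≟ u ⌋ then bit (adj G w v ∧ ⌊ col w ≟ k ⌋) else 0)
      onlyColumnU w v with v ≟ u
      ... | yes _ = refl
      ... | no _ = refl

    -- The identity holds entrywise: only row u and column u change.
    entry : ∀ w v → mono recoloured w v + (row (col u) w v + column (col u) w v)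
                  ≡ mono col w v + (row c w v + column c w v)
    entry w v with w ≟ u | v ≟ u
    ... | yes refl | yes refl rewrite irreflexive G w = refl
    ... | yes refl | no _ = exchange (bit (adj G w v ∧ ⌊ col v ≟ c ⌋)) (bit (adj G w v ∧ ⌊ col v ≟ col w ⌋))
      where
      exchange : ∀ x y → x + (y + 0) ≡ y + (x + 0)
      exchange x y rewrite +-identityʳ x | +-identityʳ y = +-comm x y
    ... | no _ | yes refl rewrite ≟-sym c (col w) | ≟-sym (col v) (col w) = +-comm (bit (adj G w v ∧ ⌊ col w ≟ c ⌋)) _
    ... | no _ | no _ = refl

    conflicts-recoloured : conflicts recoloured + (neighboursOfColour col u (col u) + neighboursOfColour col u (col u))
                         ≡ conflicts col + (neighboursOfColour col u c + neighboursOfColour col u c)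
    conflicts-recoloured = begin
      ∑∑ (mono recoloured) + (N (col u) + N (col u))
        ≡⟨ cong₂ (λ x y → ∑∑ (mono recoloured) + (x + y)) (sym (row-total (col u))) (sym (column-total (col u))) ⟩
      ∑∑ (mono recoloured) + (∑∑ (row (col u)) + ∑∑ (column (col u)))
        ≡⟨ sym (split recoloured (col u)) ⟩
      ∑∑ (λ w v → mono recoloured w v + (row (col u) w v + column (col u) w v))
        ≡⟨ sum-cong-≗ (λ w → sum-cong-≗ (entry w)) ⟩
      ∑∑ (λ w v → mono col w v + (row c w v + column c w v))
        ≡⟨ split col c ⟩
      ∑∑ (mono col) + (∑∑ (row c) + ∑∑ (column c))
        ≡⟨ cong₂ (λ x y → ∑∑ (mono col) + (x + y)) (row-total c) (column-total c) ⟩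
      ∑∑ (mono col) + (N c + N c) ∎
      where
      open ≡-Reasoning
      N = neighboursOfColour col u
      split : ∀ cl k → ∑∑ (λ w v → mono cl w v + (row k w v + column k w v))
                     ≡ ∑∑ (mono cl) + (∑∑ (row k) + ∑∑ (column k))
      split cl k = trans (∑∑-+ (mono cl) _) (cong (∑∑ (mono cl) +_) (∑∑-+ (row k) (column k)))

    conflicts-decrease : neighboursOfColour col u c < neighboursOfColour col u (col u) → conflicts recoloured < conflicts col
    conflicts-decrease fewer = +-cancelʳ-< (N (col u) + N (col u)) (conflicts recoloured) (conflicts col)
      (subst (_< conflicts col + (N (col u) + N (col u))) (sym conflicts-recoloured)
             (+-monoʳ-< (conflicts col) (+-mono-< fewer fewer)))
      where N = neighboursOfColour col u

  -- Recolour violating vertices until none is left; the potential bounds the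
  -- number of rounds.
  improve : (fuel : ℕ) (col : Colouring) → conflicts col < fuel →
    ∃ λ (col : Colouring) → ∀ u → neighboursOfColour col u (col u) ≤ Δ / suc m
  improve zero col ()
  improve (suc fuel) col lt with any? (λ u → Δ / suc m <? neighboursOfColour col u (col u))
  ... | no noViolation = col , λ u → ≮⇒≥ (λ bad → noViolation (u , bad))
  ... | yes (u , bad) with rareColour col u
  ...   | c , rare = improve fuel (Recolour.recoloured col u c)
                       (<-≤-trans (Recolour.conflicts-decrease col u c (≤-<-trans rare bad)) (≤-pred lt))

localColouring : ∀ {n} (G : Graph n) (m Δ : ℕ) → MaxDegreeAtMost G Δ →
  ∃ λ (col : Fin n → Fin (suc m)) → MaxDegreeAtMost (monochromatic G col) (Δ / suc m)
localColouring G m Δ maxDeg with improve (suc (conflicts (λ _ → fzero))) (λ _ → fzero) ≤-refl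
  where open LocalColouring G m Δ maxDeg
... | col , local = col , λ u → subst (_≤ Δ / suc m) (sym (degree-count (monochromatic G col) u)) (local u)

-- Partial independent transversals are extended
-- one part at a time by an augmenting search (see Augment below).
module IndependentTransversal {n r : ℕ} (H : Graph n) (d : ℕ)
  (degH : ∀ u → count (adj H u) ≤ d)
  (part : Fin n → Fin r)
  (nonempty : ∀ i → ∃ λ v → part v ≡ i)
  (large : ∀ i → d + d ≤ count (λ v → ⌊ part v ≟ i ⌋)) where

  Choice : Set
  Choice = Fin r → Maybe (Fin n)

  record Partial : Set where
    field
      choice : Choice
      respects : ∀ q v → choice q ≡ just v → part v ≡ q
      independent : ∀ q q′ u v → choice q ≡ just u → choice q′ ≡ just v → adj H u v ≡ false

  open Partial

  _⊑_ : Choice → Choice → Set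
  M ⊑ M′ = ∀ q v → M q ≡ just v → ∃ λ w → M′ q ≡ just w

  ⊑-trans : ∀ {M₁ M₂ M₃} → M₁ ⊑ M₂ → M₂ ⊑ M₃ → M₁ ⊑ M₃
  ⊑-trans M₁⊑M₂ M₂⊑M₃ q v e = let (w , e′) = M₁⊑M₂ q v e in M₂⊑M₃ q w e′

  adjTo : Fin n → Maybe (Fin n) → Bool
  adjTo x (just v) = adj H x v
  adjTo x nothing = false

  blocks : Choice → Fin n → Fin r → Bool
  blocks M x q = adjTo x (M q)

  blocks-chosen : ∀ M x q v → M q ≡ just v → blocks M x q ≡ adj H x v
  blocks-chosen M x q v e rewrite e = refl

  blocks-witness : ∀ M x q → blocks M x q ≡ true → ∃ λ y → M q ≡ just y × adj H x y ≡ true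
  blocks-witness M x q b with M q
  ... | just y = y , refl , b
  ... | nothing = ⊥-elim (true≢false (sym b))

  place : Choice → Fin r → Fin n → Choice
  place M q z q′ = if ⌊ q′ ≟ q ⌋ then just z else M q′

  place-here : ∀ M q z → place M q z q ≡ just z
  place-here M q z rewrite ≟-true {a = q} refl = refl

  place-cases : ∀ M q z q′ → (q′ ≡ q × place M q z q′ ≡ just z) ⊎ (¬ q′ ≡ q × place M q z q′ ≡ M q′)
  place-cases M q z q′ with q′ ≟ q
  ... | yes e = inj₁ (e , refl)
  ... | no ne = inj₂ (ne , refl)

  place-there : ∀ M q z q′ → ¬ q′ ≡ q → place M q z q′ ≡ M q′
  place-there M q z q′ q′≢q rewrite ≟-false q′≢q = refl

  place-⊑ : ∀ M q z → M ⊑ place M q z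
  place-⊑ M q z q′ v e with place-cases M q z q′
  ... | inj₁ (_ , placed) = z , placed
  ... | inj₂ (_ , kept) = v , trans kept e

  placeFree : (M : Partial) (x : Fin n) → (∀ q → blocks (choice M) x q ≡ false) → Partial
  placeFree M x free = record { choice = M′ ; respects = respects′ ; independent = independent′ }
    where
    M′ = place (choice M) (part x) x
    cases = place-cases (choice M) (part x) x

    noNeighbour : ∀ q v → choice M q ≡ just v → adj H x v ≡ false
    noNeighbour q v e = trans (sym (blocks-chosen (choice M) x q v e)) (free q)

    respects′ : ∀ q v → M′ q ≡ just v → part v ≡ q
    respects′ q v e with cases q
    ... | inj₁ (q≡px , placed) = trans (cong part (just-injective (trans (sym e) placed))) (sym q≡px)
    ... | inj₂ (_ , kept) = respects M q v (trans (sym kept) e)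

    independent′ : ∀ q q′ u v → M′ q ≡ just u → M′ q′ ≡ just v → adj H u v ≡ false
    independent′ q q′ u v eu ev with cases q | cases q′
    ... | inj₁ (_ , a) | inj₁ (_ , b)
      rewrite just-injective (trans (sym eu) a) | just-injective (trans (sym ev) b) = irreflexive H x
    ... | inj₁ (_ , a) | inj₂ (_ , b)
      rewrite just-injective (trans (sym eu) a) = noNeighbour q′ v (trans (sym b) ev)
    ... | inj₂ (_ , a) | inj₁ (_ , b)
      rewrite just-injective (trans (sym ev) b) = trans (symmetric H u x) (noNeighbour q u (trans (sym a) eu))
    ... | inj₂ (_ , a) | inj₂ (_ , b) = independent M q q′ u v (trans (sym a) eu) (trans (sym b) ev)

  -- A trail is a list of pairs (x , y) in which the chosen vertex y blocks x.
  Trail : Set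
  Trail = List (Fin n × Fin n)

  dominated : Trail → Fin n → Bool
  dominated [] z = false
  dominated ((x , y) ∷ P) z = adj H x z ∨ (adj H y z ∨ dominated P z)

  undominated-∷ : ∀ x y P z → dominated ((x , y) ∷ P) z ≡ false →
    adj H x z ≡ false × adj H y z ≡ false × dominated P z ≡ false
  undominated-∷ x y P z e =
    ∨-conicalˡ (adj H x z) _ e , ∨-conicalˡ (adj H y z) _ yP , ∨-conicalʳ (adj H y z) _ yP
    where yP = ∨-conicalʳ (adj H x z) _ e

  dominatedVertices : ∀ P → count (dominated P) ≤ length P * (d + d)
  dominatedVertices [] = ≤-reflexive (sum-replicate-zero n)
  dominatedVertices ((x , y) ∷ P) = begin
    count (dominated ((x , y) ∷ P))                  ≤⟨ count-∨ (adj H x) _ ⟩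
    count (adj H x) + count (λ z → adj H y z ∨ dominated P z)
                                                     ≤⟨ +-monoʳ-≤ (count (adj H x)) (count-∨ (adj H y) (dominated P)) ⟩
    count (adj H x) + (count (adj H y) + count (dominated P))
                                                     ≤⟨ +-mono-≤ (degH x) (+-mono-≤ (degH y) (dominatedVertices P)) ⟩
    d + (d + length P * (d + d))                     ≡⟨ sym (+-assoc d d _) ⟩
    length ((x , y) ∷ P) * (d + d)                   ∎
    where open ≤-Reasoning

  Chosen : Choice → Trail → Set
  Chosen M [] = ⊤
  Chosen M ((x , y) ∷ P) = M (part y) ≡ just y × Chosen M P

  NoNewBlocks : Choice → Choice → Trail → Set
  NoNewBlocks M M′ [] = ⊤
  NoNewBlocks M M′ ((x , y) ∷ P) = (∀ q → blocks M′ x q ≡ true → blocks M x q ≡ true) × NoNewBlocks M M′ P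

  NoNewBlocks-trans : ∀ {M₁ M₂ M₃} P → NoNewBlocks M₁ M₂ P → NoNewBlocks M₂ M₃ P → NoNewBlocks M₁ M₃ P
  NoNewBlocks-trans [] _ _ = tt
  NoNewBlocks-trans ((x , y) ∷ P) (old₁ , rest₁) (old₂ , rest₂) = (λ q → old₁ q ∘ old₂ q) , NoNewBlocks-trans P rest₁ rest₂

  NoNewBlocks-place : ∀ M q z P → dominated P z ≡ false → NoNewBlocks M (place M q z) P
  NoNewBlocks-place M q z [] _ = tt
  NoNewBlocks-place M q z ((x , y) ∷ P) undom with undominated-∷ x y P z undom
  ... | xz , _ , rest = noNew , NoNewBlocks-place M q z P rest
    where
    noNew : ∀ q′ → blocks (place M q z) x q′ ≡ true → blocks M x q′ ≡ true
    noNew q′ b with place-cases M q z q′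
    ... | inj₁ (_ , placed) = ⊥-elim (true≢false (trans (sym b) (trans (blocks-chosen (place M q z) x q′ z placed) xz)))
    ... | inj₂ (_ , kept) = trans (cong (adjTo x) (sym kept)) b

  -- Overwriting the chosen vertex y of a part keeps the trail R chosen when y
  -- is a neighbour of a vertex x undominated by R (so y is not on R).
  Chosen-place : ∀ M q z x y R → Chosen M R → dominated R x ≡ false → adj H x y ≡ true → M q ≡ just y →
    Chosen (place M q z) R
  Chosen-place M q z x y [] _ _ _ _ = tt
  Chosen-place M q z x y ((x′ , y′) ∷ R) (y′-chosen , chosen) undom xy y-chosen
    with undominated-∷ x′ y′ R x undom
  ... | _ , y′x , rest with place-cases M q z (part y′)
  ...   | inj₁ (y′∈q , _) = ⊥-elim (true≢false (trans (sym xy) (trans (cong (adj H x) y≡y′) (trans (symmetric H x y′) y′x))))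
    where
    y≡y′ : y ≡ y′
    y≡y′ = just-injective (trans (sym y-chosen) (trans (cong M (sym y′∈q)) y′-chosen))
  ...   | inj₂ (_ , kept) = trans kept y′-chosen , Chosen-place M q z x y R chosen rest xy y-chosen

  size : Fin r → ℕ
  size i = count (λ v → ⌊ part v ≟ i ⌋)

  -- Augmenting a partial independent transversal M that misses the part p.
  -- The search grows a chain of pairs (x , y): x lies in a touched part (p or
  -- the part of an earlier y), is not dominated by the earlier pairs, and is
  -- blocked by the chosen vertex y.  As the parts stay large, an undominated
  -- vertex of a touched part always exists.  If it has no chosen neighbour it
  -- is placed in its part, which either covers p or releases an earlier x
  -- from its blocker, after which the search resumes at that x.
  -- Termination: the number of untouched parts decreases along the chain, and
  -- the number of blockers of x decreases at every resumption at x.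
  module Augment (p : Fin r) where

    touched : Trail → Fin r → Bool
    touched [] q = ⌊ q ≟ p ⌋
    touched ((x , y) ∷ P) q = ⌊ q ≟ part y ⌋ ∨ touched P q

    untouched : Trail → ℕ
    untouched P = count (λ q → not (touched P q))

    data Chain : Trail → Set where
      root : Chain []
      link : ∀ {P} x y → Chain P → touched P (part x) ≡ true → dominated P x ≡ false → adj H x y ≡ true →
             Chain ((x , y) ∷ P)

    Released : Choice → Trail → Set
    Released M [] = ⊥
    Released M ((x , y) ∷ P) = (blocks M x (part y) ≡ false × Chosen M P) ⊎ Released M P

    record Covers (M : Partial) : Set where
      field
        extension : Partial
        grows : choice M ⊑ choice extension
        covered : ∃ λ w → choice extension p ≡ just w

    record Retreat (M : Partial) (P : Trail) : Set where
      field
        extension : Partial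
        grows : choice M ⊑ choice extension
        uncovered : choice extension p ≡ nothing
        noNewBlocks : NoNewBlocks (choice M) (choice extension) P
        released : Released (choice extension) P

    record Position (M : Partial) (P : Trail) (x : Fin n) : Set where
      field
        chain : Chain P
        chosen : Chosen (choice M) P
        uncovered : choice M p ≡ nothing
        x-touched : touched P (part x) ≡ true
        x-undominated : dominated P x ≡ false

    fresh : ∀ M P q x y → Chosen M P → M p ≡ nothing → M q ≡ just y → adj H x y ≡ true → dominated P x ≡ false →
      touched P q ≡ false
    fresh M [] q x y _ p-free y-chosen _ _ = ≟-false (λ q≡p → nothing≢just (trans (sym p-free) (trans (cong M (sym q≡p)) y-chosen)))
      where
      nothing≢just : ∀ {v : Fin n} → nothing ≡ just v → ⊥
      nothing≢just ()
    fresh M ((x′ , y′) ∷ P) q x y (y′-chosen , chosen) p-free y-chosen xy undom with undominated-∷ x′ y′ P x undom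
    ... | _ , y′x , rest with q ≟ part y′
    ...   | yes q≡y′ = ⊥-elim (true≢false (trans (sym xy) (trans (cong (adj H x) y≡y′) (trans (symmetric H x y′) y′x))))
      where
      y≡y′ : y ≡ y′
      y≡y′ = just-injective (trans (sym y-chosen) (trans (cong M q≡y′) y′-chosen))
    ...   | no _ = fresh M P q x y chosen p-free y-chosen xy rest

    -- The touched parts are pairwise distinct, so together they contain at
    -- least size p + 2d·|P| vertices.
    touchedVertices : ∀ M P → Chain P → Chosen M P → M p ≡ nothing →
      size p + length P * (d + d) ≤ count (λ z → touched P (part z))
    touchedVertices M [] root _ _ = ≤-reflexive (+-identityʳ _)
    touchedVertices M ((x , y) ∷ P) (link .x .y chain _ undom xy) (y-chosen , chosen) p-free = begin
      size p + (d + d + length P * (d + d))           ≡⟨ +-swap (size p) (d + d) _ ⟩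
      d + d + (size p + length P * (d + d))           ≤⟨ +-mono-≤ (large (part y)) (touchedVertices M P chain chosen p-free) ⟩
      size (part y) + count (λ z → touched P (part z)) ≤⟨ count-disjoint _ _ disjoint ⟩
      count (λ z → touched ((x , y) ∷ P) (part z))    ∎
      where
      open ≤-Reasoning
      +-swap : ∀ a b c → a + (b + c) ≡ b + (a + c)
      +-swap a b c = trans (sym (+-assoc a b c)) (trans (cong (_+ c) (+-comm a b)) (+-assoc b a c))
      new : touched P (part y) ≡ false
      new = fresh M P (part y) x y chosen p-free y-chosen xy undom
      disjoint : ∀ z → ⌊ part z ≟ part y ⌋ ≡ true → touched P (part z) ≡ true → ⊥
      disjoint z inY t with part z ≟ part y
      ... | yes z∈y = true≢false (trans (sym t) (trans (cong (touched P) z∈y) new))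
      ... | no _ = true≢false (sym inY)

    candidate : ∀ M P → Chain P → Chosen M P → M p ≡ nothing →
      ∃ λ z → touched P (part z) ≡ true × dominated P z ≡ false
    candidate M P chain chosen p-free with count-witness good (+-cancelʳ-≤ K 1 (count good) bound)
      where
      K = length P * (d + d)
      t = λ z → touched P (part z)
      good = λ z → t z ∧ not (dominated P z)
      splitting : ∀ a b → a ≡ true → a ∧ not b ∨ b ≡ true
      splitting true true _ = refl
      splitting true false _ = refl
      p-inhabited : 1 ≤ size p
      p-inhabited = let (v , v∈p) = nonempty p in
        ≤-trans (s≤s z≤n) (count-mono-< {f = λ _ → false} (λ _ ()) v refl (≟-true v∈p))
      bound : 1 + K ≤ count good + K
      bound = begin
        1 + K                                       ≤⟨ +-monoˡ-≤ K p-inhabited ⟩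
        size p + K                                  ≤⟨ touchedVertices M P chain chosen p-free ⟩
        count t                                     ≤⟨ count-mono (λ z → splitting (t z) (dominated P z)) ⟩
        count (λ z → good z ∨ dominated P z)        ≤⟨ count-∨ good (dominated P) ⟩
        count good + count (dominated P)            ≤⟨ +-monoʳ-≤ (count good) (dominatedVertices P) ⟩
        count good + K                              ∎
        where open ≤-Reasoning
    ... | z , good-z = z , touched-and-undominated _ _ good-z
      where
      touched-and-undominated : ∀ a b → a ∧ not b ≡ true → a ≡ true × b ≡ false
      touched-and-undominated true false _ = refl , refl

    releasedByPlacing : ∀ M x P → Chain P → Chosen M P → touched P (part x) ≡ true → ¬ part x ≡ p →
      dominated P x ≡ false → Released (place M (part x) x) P
    releasedByPlacing M x [] root _ t x∉p _ = ⊥-elim (true≢false (trans (sym t) (≟-false x∉p)))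
    releasedByPlacing M x ((x′ , y′) ∷ R) (link .x′ .y′ chain _ undom′ x′y′) (y′-chosen , chosen) t x∉p undom
      with undominated-∷ x′ y′ R x undom
    ... | x′x , _ , rest with part x ≟ part y′
    ...   | yes x∈y′ = inj₁ (trans (blocks-chosen (place M (part x) x) x′ (part y′) x x-placed) x′x ,
                             Chosen-place M (part x) x x′ y′ R chosen undom′ x′y′ (trans (cong M x∈y′) y′-chosen))
      where
      x-placed : place M (part x) x (part y′) ≡ just x
      x-placed = trans (cong (place M (part x) x) (sym x∈y′)) (place-here M (part x) x)
    ...   | no _ = inj₂ (releasedByPlacing M x R chain chosen t x∉p rest)

    open Position

    settle : ∀ M P x → Position M P x → (∀ q → blocks (choice M) x q ≡ false) → Covers M ⊎ Retreat M P
    settle M P x pos free with part x ≟ p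
    ... | yes x∈p = inj₁ record
      { extension = placeFree M x free
      ; grows = place-⊑ _ _ _
      ; covered = x , trans (cong (place (choice M) (part x) x) (sym x∈p)) (place-here (choice M) (part x) x)
      }
    ... | no x∉p = inj₂ record
      { extension = placeFree M x free
      ; grows = place-⊑ _ _ _
      ; uncovered = trans (place-there (choice M) (part x) x p (x∉p ∘ sym)) (uncovered pos)
      ; noNewBlocks = NoNewBlocks-place _ _ _ P (x-undominated pos)
      ; released = releasedByPlacing (choice M) x P (chain pos) (chosen pos) (x-touched pos) x∉p (x-undominated pos)
      }

    push : ∀ M P x y → Position M P x → choice M (part y) ≡ just y → adj H x y ≡ true →
      untouched ((x , y) ∷ P) < untouched P × ∃ λ x′ → Position M ((x , y) ∷ P) x′
    push M P x y pos y-chosen xy = shrinks , x′ , record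
      { chain = chain′ ; chosen = chosen′ ; uncovered = uncovered pos
      ; x-touched = proj₁ (proj₂ next) ; x-undominated = proj₂ (proj₂ next) }
      where
      new : touched P (part y) ≡ false
      new = fresh (choice M) P (part y) x y (chosen pos) (uncovered pos) y-chosen xy (x-undominated pos)
      not-∨ : ∀ a b → not (a ∨ b) ≡ true → not b ≡ true
      not-∨ false b e = e
      shrinks : untouched ((x , y) ∷ P) < untouched P
      shrinks = count-mono-< (λ q → not-∨ ⌊ q ≟ part y ⌋ (touched P q)) (part y)
        (cong (λ b → not (b ∨ touched P (part y))) (≟-true refl)) (cong not new)
      chain′ = link x y (chain pos) (x-touched pos) (x-undominated pos) xy
      chosen′ = y-chosen , chosen pos
      next = candidate (choice M) ((x , y) ∷ P) chain′ chosen′ (uncovered pos)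
      x′ = proj₁ next

    retreat-then-covers : ∀ {M P} (back : Retreat M P) → Covers (Retreat.extension back) → Covers M
    retreat-then-covers back covers = record
      { extension = Covers.extension covers
      ; grows = ⊑-trans (Retreat.grows back) (Covers.grows covers)
      ; covered = Covers.covered covers
      }

    retreat-then-retreat : ∀ {M x y P} (back : Retreat M ((x , y) ∷ P)) → Retreat (Retreat.extension back) P → Retreat M P
    retreat-then-retreat {P = P} back back′ = record
      { extension = Retreat.extension back′
      ; grows = ⊑-trans (Retreat.grows back) (Retreat.grows back′)
      ; uncovered = Retreat.uncovered back′
      ; noNewBlocks = NoNewBlocks-trans P (proj₂ (Retreat.noNewBlocks back)) (Retreat.noNewBlocks back′)
      ; released = Retreat.released back′
      }

    retreat-below : ∀ {M x y P} (back : Retreat M ((x , y) ∷ P)) → Released (choice (Retreat.extension back)) P → Retreat M P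
    retreat-below back released = record
      { extension = Retreat.extension back
      ; grows = Retreat.grows back
      ; uncovered = Retreat.uncovered back
      ; noNewBlocks = proj₂ (Retreat.noNewBlocks back)
      ; released = released
      }

    -- The search from x, by induction on the number f of untouched parts and,
    -- inside, on a bound g for the number of blockers of x.
    Exploration : ℕ → Set
    Exploration f = ∀ g M P x → untouched P ≤ f → count (blocks (choice M) x) < g →
      Position M P x → Covers M ⊎ Retreat M P

    ExplorationBelow : ℕ → Set
    ExplorationBelow zero = ⊤
    ExplorationBelow (suc f) = Exploration f

    explore : ∀ f → ExplorationBelow f → Exploration f
    descend : ∀ f → ExplorationBelow f → ∀ g M P x → untouched P ≤ f → count (blocks (choice M) x) < suc g →
      Position M P x → ∀ y → choice M (part y) ≡ just y → adj H x y ≡ true → Covers M ⊎ Retreat M P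

    explore f below zero M P x _ () _
    explore f below (suc g) M P x few blockers pos with search (blocks (choice M) x)
    ... | inj₂ free = settle M P x pos free
    ... | inj₁ (q , blocked) with blocks-witness (choice M) x q blocked
    ...   | y , y-chosen , xy =
      descend f below g M P x few blockers pos y (trans (cong (choice M) (respects M q y y-chosen)) y-chosen) xy

    -- After pushing (x , y): a release of a lower pair is passed down; a
    -- release of x itself means x lost a blocker, and the search resumes at x.
    descend f below g M P x few blockers pos y y-chosen xy with push M P x y pos y-chosen xy
    descend zero _ g M P x few _ _ y _ _ | shrinks , _ = ⊥-elim (n≮0 (<-≤-trans shrinks few))
    descend (suc f) below g M P x few blockers pos y y-chosen xy | shrinks , x′ , pos′
      with below (suc r) M ((x , y) ∷ P) x′ (≤-pred (<-≤-trans shrinks few)) (s≤s (count-≤-size _)) pos′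
    ... | inj₁ covers = inj₁ covers
    ... | inj₂ back with Retreat.released back
    ...   | inj₂ lower = inj₂ (retreat-below back lower)
    ...   | inj₁ (x-released , chosen′)
      with explore (suc f) below g (Retreat.extension back) P x few fewer
             (record { chain = chain pos ; chosen = chosen′ ; uncovered = Retreat.uncovered back
                     ; x-touched = x-touched pos ; x-undominated = x-undominated pos })
      where
      fewer : count (blocks (choice (Retreat.extension back)) x) < g
      fewer = <-≤-trans (count-mono-< (proj₁ (Retreat.noNewBlocks back)) (part y) x-released
                           (trans (blocks-chosen (choice M) x (part y) y y-chosen) xy))
                        (≤-pred blockers)
    ...     | inj₁ covers = inj₁ (retreat-then-covers back covers)
    ...     | inj₂ back′ = inj₂ (retreat-then-retreat back back′)

    exploreAll : ∀ f → Exploration f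
    exploreAll zero = explore zero tt
    exploreAll (suc f) = explore (suc f) (exploreAll f)

    -- A search started in p itself cannot retreat, as there is nothing to release.
    augment : (M : Partial) → choice M p ≡ nothing → Covers M
    augment M p-free with candidate (choice M) [] root tt p-free
    ... | x , x-touched , x-undominated
      with exploreAll r (suc r) M [] x (count-≤-size _) (s≤s (count-≤-size _))
             (record { chain = root ; chosen = tt ; uncovered = p-free ; x-touched = x-touched ; x-undominated = x-undominated })
    ...   | inj₁ covers = covers
    ...   | inj₂ back = ⊥-elim (Retreat.released back)

  coverAll : (L : List (Fin r)) → Σ Partial λ M → ∀ q → q ∈ L → ∃ λ w → choice M q ≡ just w
  coverAll [] = record { choice = λ _ → nothing ; respects = λ _ _ () ; independent = λ _ _ _ _ () } , λ _ ()
  coverAll (q ∷ L) with coverAll L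
  ... | M , covered with choice M q in eq
  ...   | just w = M , λ { q′ (here refl) → w , eq ; q′ (there q′∈L) → covered q′ q′∈L }
  ...   | nothing = Augment.Covers.extension c , λ
          { q′ (here refl) → Augment.Covers.covered c
          ; q′ (there q′∈L) → let (w , e) = covered q′ q′∈L in Augment.Covers.grows c q′ w e }
    where c = Augment.augment q M eq

  independentTransversal : ∃ λ (Tr : Transversal part) → ∀ i j → adj H (pick Tr i) (pick Tr j) ≡ false
  independentTransversal = Tr , λ i j → independent M i j _ _ (proj₂ (chosenIn i)) (proj₂ (chosenIn j))
    where
    M = proj₁ (coverAll (allFin r))
    chosenIn : ∀ i → ∃ λ w → choice M i ≡ just w
    chosenIn i = proj₂ (coverAll (allFin r)) i (∈-allFin i)
    Tr : Transversal part
    Tr = record { pick = λ i → proj₁ (chosenIn i) ; pick-in = λ i → respects M i _ (proj₂ (chosenIn i)) }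

haxell : ∀ {n r} (H : Graph n) (d : ℕ) → MaxDegreeAtMost H d →
  (part : Fin n → Fin r) → (∀ i → ∃ λ v → part v ≡ i) → (∀ i → 2 * d ≤ partSize part i) →
  ∃ λ (Tr : Transversal part) → ∀ i j → adj H (pick Tr i) (pick Tr j) ≡ false
haxell H d maxDeg part nonempty large = IndependentTransversal.independentTransversal H d
  (λ u → subst (_≤ d) (degree-count H u) (maxDeg u)) part nonempty
  (λ i → subst₂ _≤_ (cong (d +_) (+-identityʳ d)) (length-filter (λ v → ⌊ part v ≟ i ⌋) id) (large i))

-- With k colours, a transversal independent in the monochromatic subgraph has
-- no clique on k + 1 vertices: two of them share a colour by pigeonhole.
noLargeClique : ∀ {n r m} (G : Graph n) {part : Fin n → Fin r} (col : Fin n → Fin (suc m)) (Tr : Transversal part) →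
  (∀ i j → adj (monochromatic G col) (pick Tr i) (pick Tr j) ≡ false) → KsFree G Tr (suc (suc m))
noLargeClique G col Tr independent (c , inTr , clique) with pigeonhole (n<1+n _) (col ∘ c)
... | j , k , j<k , sameColour with inTr j | inTr k
...   | i , pick-i | i′ , pick-i′ = true≢false (trans (sym edge) nonEdge)
  where
  edge : adj (monochromatic G col) (c j) (c k) ≡ true
  edge = cong₂ _∧_ (Equivalence.to T-≡ (clique j k (<⇒≢ᶠ j<k))) (≟-true (sym sameColour))
  nonEdge : adj (monochromatic G col) (c j) (c k) ≡ false
  nonEdge = subst₂ (λ u v → adj (monochromatic G col) u v ≡ false) pick-i pick-i′ (independent i i′)

proposition11 : (s Δ n r : ℕ) → 2 ≤ s → (G : Graph n) → MaxDegreeAtMost G Δ →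
    (part : Fin n → Fin r) →
    (∀ i → ∃ λ v → part v ≡ i) →
    (∀ i → 2 * floorDiv Δ (s ∸ 1) ≤ partSize part i) →
    ∃ λ (Tr : Transversal part) → KsFree G Tr s
proposition11 (suc (suc m)) Δ n r (s≤s (s≤s z≤n)) G maxDeg part nonempty large
  with localColouring G m Δ maxDeg
... | col , colourDegree with haxell (monochromatic G col) (Δ / suc m) colourDegree part nonempty large
...   | Tr , independent = Tr , noLargeClique G col Tr independent
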